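{- Let $\Gamma,\Delta,\Gamma',\Delta'$ be finite multisets of formulas with $\Gamma$ a sub-multiset of $\Gamma'$ and $\Delta$ a sub-multiset of $\Delta'$. If $\Gamma\longrightarrow\Delta$ has a C-proof of nonconstructiveness measure $n$, then $\Gamma'\longrightarrow\Delta'$ has a C-proof of nonconstructiveness measure at most $n$.
   Context: Formulas are first-order with logical symbols $\top,\bot,\land,\lor,\supset,\exists,\forall$; $\top,\bot$ are not atomic. A sequent $\Gamma\longrightarrow\Delta$ is a pair of finite multisets of formulas. A C-proof is a derivation in the classical multiple-succedent sequent calculus whose axioms are sequents with $\top\in\Delta$ or with some $A$ ($\bot$ or atomic) in both $\Gamma$ and $\Delta$, and whose rules are: contr-L ($B,B,\Gamma\longrightarrow\Delta\Rightarrow B,\Gamma\longrightarrow\Delta$), contr-R ($\Gamma\longrightarrow\Delta,B,B\Rightarrow\Gamma\longrightarrow\Delta,B$), $\bot$-R ($\Gamma\longrightarrow\Delta,\bot\Rightarrow\Gamma\longrightarrow\Delta,D$), $\land$-L ($B,D,B\land D,\Gamma\longrightarrow\Delta\Rightarrow B\land D,\Gamma\longrightarrow\Delta$), $\land$-R ($\Gamma\longrightarrow\Delta,B$ and $\Gamma\longrightarrow\Delta,D\Rightarrow\Gamma\longrightarrow\Delta,B\land D$), $\lor$-L ($B,\Gamma\longrightarrow\Delta$ and $D,\Gamma\longrightarrow\Delta\Rightarrow B\lor D,\Gamma\longrightarrow\Delta$), $\lor$-R ($\Gamma\longrightarrow\Delta,B$ or $\Gamma\longrightarrow\Delta,D\Rightarrow\Gamma\longrightarrow\Delta,B\lor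 D$), $\supset$-L ($B\supset D,\Gamma\longrightarrow B,\Delta$ and $D,\Gamma\longrightarrow\Theta\Rightarrow B\supset D,\Gamma\longrightarrow\Delta,\Theta$), $\supset$-R ($B,\Gamma\longrightarrow\Delta,D\Rightarrow\Gamma\longrightarrow\Delta,B\supset D$), $\forall$-L ($[t/x]B,\forall xB,\Gamma\longrightarrow\Delta\Rightarrow\forall xB,\Gamma\longrightarrow\Delta$), $\exists$-R ($\Gamma\longrightarrow\Delta,[t/x]B\Rightarrow\Gamma\longrightarrow\Delta,\exists xB$), $\exists$-L ($[c/x]B,\Gamma\longrightarrow\Delta\Rightarrow\exists xB,\Gamma\longrightarrow\Delta$), $\forall$-R ($\Gamma\longrightarrow\Delta,[c/x]B\Rightarrow\Gamma\longrightarrow\Delta,\forall xB$), $c$ a constant not in the lower sequent. An I-proof is a C-proof in which every sequent has exactly one succedent formula. In a C-proof $\Xi$, an occurrence of $\lor$-L with lower sequent $B\lor D,\Gamma\longrightarrow\Delta$ is nonconstructive if there is no $F\in\Delta$ such that both $B,\Gamma\longrightarrow F$ and $D,\Gamma\longrightarrow F$ have I-proofs; an occurrence of $\supset$-R with upper sequent $B,\Gamma\longrightarrow\Delta,D$ is nonconstructive if $B,\Gamma\longrightarrow D$ has no I-proof. The nonconstructiveness measure $\mu(\Xi)$ is the number of nonconstructive occurrences of $\lor$-L and $\supset$-R rules in $\Xi$. -}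

module Defs where

open import Data.Nat using (ℕ; zero; suc; _+_; _<ᵇ_; _≡ᵇ_; _∸_)
open import Data.Bool using (if_then_else_)
open import Data.List using (List; []; _∷_; _++_; length)
open import Data.List.Membership.Propositional using (_∈_)
open import Data.List.Relation.Unary.Any using (Any)
open import Data.List.Relation.Binary.Permutation.Propositional using (_↭_)
open import Data.Product using (Σ; _×_; ∃)
open import Data.Sum using (_⊎_)
open import Data.Empty using (⊥)
open import Data.Unit using (⊤)
open import Relation.Nullary using (¬_)
open import Relation.Binary.PropositionalEquality using (_≡_)

-- First-order terms and formulas (bound variables as de Bruijn indices;
-- eigenvariable constants are  cst c ; function symbols are untyped).

data Term : Set where
  var : ℕ → Term
  cst : ℕ → Term
  fn  : ℕ → List Term → Term

infixr 6 _∧'_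
infixr 5 _∨'_
infixr 4 _⊃'_

data Formula : Set where
  atom : ℕ → List Term → Formula
  ⊤'   : Formula
  ⊥'   : Formula
  _∧'_ : Formula → Formula → Formula
  _∨'_ : Formula → Formula → Formula
  _⊃'_ : Formula → Formula → Formula
  ∀'   : Formula → Formula
  ∃'   : Formula → Formula

mutual
  shiftT : ℕ → Term → Term
  shiftT k (var i) = if i <ᵇ k then var i else var (suc i)
  shiftT k (cst c) = cst c
  shiftT k (fn f ts) = fn f (shiftTs k ts)

  shiftTs : ℕ → List Term → List Term
  shiftTs k [] = []
  shiftTs k (t ∷ ts) = shiftT k t ∷ shiftTs k ts

mutual
  substT : ℕ → Term → Term → Term
  substT k u (var i) =
    if i ≡ᵇ k then u else (if i <ᵇ k then var i else var (i ∸ 1))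
  substT k u (cst c) = cst c
  substT k u (fn f ts) = fn f (substTs k u ts)

  substTs : ℕ → Term → List Term → List Term
  substTs k u [] = []
  substTs k u (t ∷ ts) = substT k u t ∷ substTs k u ts

substF : ℕ → Term → Formula → Formula
substF k u (atom p ts) = atom p (substTs k u ts)
substF k u ⊤' = ⊤'
substF k u ⊥' = ⊥'
substF k u (A ∧' B) = substF k u A ∧' substF k u B
substF k u (A ∨' B) = substF k u A ∨' substF k u B
substF k u (A ⊃' B) = substF k u A ⊃' substF k u B
substF k u (∀' A) = ∀' (substF (suc k) (shiftT 0 u) A)
substF k u (∃' A) = ∃' (substF (suc k) (shiftT 0 u) A)

inst : Formula → Term → Formula
inst B t = substF 0 t B

mutual
  OccT : ℕ → Term → Set
  OccT c (var i) = ⊥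
  OccT c (cst d) = c ≡ d
  OccT c (fn f ts) = OccTs c ts

  OccTs : ℕ → List Term → Set
  OccTs c [] = ⊥
  OccTs c (t ∷ ts) = OccT c t ⊎ OccTs c ts

OccF : ℕ → Formula → Set
OccF c (atom p ts) = OccTs c ts
OccF c ⊤' = ⊥
OccF c ⊥' = ⊥
OccF c (A ∧' B) = OccF c A ⊎ OccF c B
OccF c (A ∨' B) = OccF c A ⊎ OccF c B
OccF c (A ⊃' B) = OccF c A ⊎ OccF c B
OccF c (∀' A) = OccF c A
OccF c (∃' A) = OccF c A

FreshIn : ℕ → List Formula → List Formula → Set
FreshIn c Γ Δ = ¬ Any (OccF c) Γ × ¬ Any (OccF c) Δ

data AtomOrBot : Formula → Set where
  isAtom : ∀ p ts → AtomOrBot (atom p ts)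
  isBot  : AtomOrBot ⊥'

-- Multisets are lists; the rule  perm  (exchange) identifies
-- sequents up to permutation of antecedent / succedent, i.e. works with
-- multisets. Principal formulas are at the head of the lists.

data CProof : List Formula → List Formula → Set where
  ax⊤    : ∀ {Γ Δ} → ⊤' ∈ Δ → CProof Γ Δ
  axA    : ∀ {Γ Δ A} → AtomOrBot A → A ∈ Γ → A ∈ Δ → CProof Γ Δ
  perm   : ∀ {Γ Γ' Δ Δ'} → Γ ↭ Γ' → Δ ↭ Δ' → CProof Γ Δ → CProof Γ' Δ'
  contrL : ∀ {Γ Δ B} → CProof (B ∷ B ∷ Γ) Δ → CProof (B ∷ Γ) Δ
  contrR : ∀ {Γ Δ B} → CProof Γ (B ∷ B ∷ Δ) → CProof Γ (B ∷ Δ)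
  ⊥R     : ∀ {Γ Δ} D → CProof Γ (⊥' ∷ Δ) → CProof Γ (D ∷ Δ)
  ∧L     : ∀ {Γ Δ B D} → CProof (B ∷ D ∷ (B ∧' D) ∷ Γ) Δ → CProof ((B ∧' D) ∷ Γ) Δ
  ∧R     : ∀ {Γ Δ B D} → CProof Γ (B ∷ Δ) → CProof Γ (D ∷ Δ) → CProof Γ ((B ∧' D) ∷ Δ)
  ∨L     : ∀ {Γ Δ B D} → CProof (B ∷ Γ) Δ → CProof (D ∷ Γ) Δ → CProof ((B ∨' D) ∷ Γ) Δ
  ∨R₁    : ∀ {Γ Δ B} D → CProof Γ (B ∷ Δ) → CProof Γ ((B ∨' D) ∷ Δ)
  ∨R₂    : ∀ {Γ Δ D} B → CProof Γ (D ∷ Δ) → CProof Γ ((B ∨' D) ∷ Δ)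
  ⊃L     : ∀ {Γ Δ Θ B D} → CProof ((B ⊃' D) ∷ Γ) (B ∷ Δ) → CProof (D ∷ Γ) Θ
           → CProof ((B ⊃' D) ∷ Γ) (Δ ++ Θ)
  ⊃R     : ∀ {Γ Δ B D} → CProof (B ∷ Γ) (D ∷ Δ) → CProof Γ ((B ⊃' D) ∷ Δ)
  ∀L     : ∀ {Γ Δ B} (t : Term) → CProof (inst B t ∷ ∀' B ∷ Γ) Δ → CProof (∀' B ∷ Γ) Δ
  ∃R     : ∀ {Γ Δ B} (t : Term) → CProof Γ (inst B t ∷ Δ) → CProof Γ (∃' B ∷ Δ)
  ∃L     : ∀ {Γ Δ B} (c : ℕ) → FreshIn c (∃' B ∷ Γ) Δ
           → CProof (inst B (cst c) ∷ Γ) Δ → CProof (∃' B ∷ Γ) Δ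
  ∀R     : ∀ {Γ Δ B} (c : ℕ) → FreshIn c Γ (∀' B ∷ Δ)
           → CProof Γ (inst B (cst c) ∷ Δ) → CProof Γ (∀' B ∷ Δ)

-- I-proofs: C-proofs in which every sequent has exactly one succedent formula.

One : List Formula → Set
One Δ = length Δ ≡ 1

AllSingle : ∀ {Γ Δ} → CProof Γ Δ → Set
AllSingle {Δ = Δ} (ax⊤ _) = One Δ
AllSingle {Δ = Δ} (axA _ _ _) = One Δ
AllSingle {Δ = Δ} (perm _ _ d) = One Δ × AllSingle d
AllSingle {Δ = Δ} (contrL d) = One Δ × AllSingle d
AllSingle {Δ = Δ} (contrR d) = One Δ × AllSingle d
AllSingle {Δ = Δ} (⊥R _ d) = One Δ × AllSingle d
AllSingle {Δ = Δ} (∧L d) = One Δ × AllSingle d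
AllSingle {Δ = Δ} (∧R d e) = One Δ × AllSingle d × AllSingle e
AllSingle {Δ = Δ} (∨L d e) = One Δ × AllSingle d × AllSingle e
AllSingle {Δ = Δ} (∨R₁ _ d) = One Δ × AllSingle d
AllSingle {Δ = Δ} (∨R₂ _ d) = One Δ × AllSingle d
AllSingle {Δ = Δ} (⊃L d e) = One Δ × AllSingle d × AllSingle e
AllSingle {Δ = Δ} (⊃R d) = One Δ × AllSingle d
AllSingle {Δ = Δ} (∀L _ d) = One Δ × AllSingle d
AllSingle {Δ = Δ} (∃R _ d) = One Δ × AllSingle d
AllSingle {Δ = Δ} (∃L _ _ d) = One Δ × AllSingle d
AllSingle {Δ = Δ} (∀R _ _ d) = One Δ × AllSingle d

IProvable : List Formula → Formula → Set
IProvable Γ F = Σ (CProof Γ (F ∷ [])) AllSingle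

NonConstr∨L : Formula → Formula → List Formula → List Formula → Set
NonConstr∨L B D Γ Δ = ¬ (∃ λ F → F ∈ Δ × IProvable (B ∷ Γ) F × IProvable (D ∷ Γ) F)

NonConstr⊃R : Formula → List Formula → Formula → Set
NonConstr⊃R B Γ D = ¬ IProvable (B ∷ Γ) D

data Measure : ∀ {Γ Δ} → CProof Γ Δ → ℕ → Set where
  m-ax⊤    : ∀ {Γ Δ} {p : ⊤' ∈ Δ} → Measure {Γ} {Δ} (ax⊤ p) 0
  m-axA    : ∀ {Γ Δ A} {a : AtomOrBot A} {p : A ∈ Γ} {q : A ∈ Δ} → Measure {Γ} {Δ} (axA a p q) 0
  m-perm   : ∀ {Γ Γ' Δ Δ' n} {π : Γ ↭ Γ'} {ρ : Δ ↭ Δ'} {d : CProof Γ Δ}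
             → Measure d n → Measure (perm π ρ d) n
  m-contrL : ∀ {Γ Δ B n} {d : CProof (B ∷ B ∷ Γ) Δ} → Measure d n → Measure (contrL d) n
  m-contrR : ∀ {Γ Δ B n} {d : CProof Γ (B ∷ B ∷ Δ)} → Measure d n → Measure (contrR d) n
  m-⊥R     : ∀ {Γ Δ D n} {d : CProof Γ (⊥' ∷ Δ)} → Measure d n → Measure (⊥R D d) n
  m-∧L     : ∀ {Γ Δ B D n} {d : CProof (B ∷ D ∷ (B ∧' D) ∷ Γ) Δ} → Measure d n → Measure (∧L d) n
  m-∧R     : ∀ {Γ Δ B D m n} {d : CProof Γ (B ∷ Δ)} {e : CProof Γ (D ∷ Δ)}
             → Measure d m → Measure e n → Measure (∧R d e) (m + n)
  m-∨L-nc  : ∀ {Γ Δ B D m n} {d : CProof (B ∷ Γ) Δ} {e : CProof (D ∷ Γ) Δ}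
             → NonConstr∨L B D Γ Δ → Measure d m → Measure e n → Measure (∨L d e) (suc (m + n))
  m-∨L-c   : ∀ {Γ Δ B D m n} {d : CProof (B ∷ Γ) Δ} {e : CProof (D ∷ Γ) Δ}
             → ¬ NonConstr∨L B D Γ Δ → Measure d m → Measure e n → Measure (∨L d e) (m + n)
  m-∨R₁    : ∀ {Γ Δ B D n} {d : CProof Γ (B ∷ Δ)} → Measure d n → Measure (∨R₁ D d) n
  m-∨R₂    : ∀ {Γ Δ B D n} {d : CProof Γ (D ∷ Δ)} → Measure d n → Measure (∨R₂ B d) n
  m-⊃L     : ∀ {Γ Δ Θ B D m n} {d : CProof ((B ⊃' D) ∷ Γ) (B ∷ Δ)} {e : CProof (D ∷ Γ) Θ}
             → Measure d m → Measure e n → Measure (⊃L d e) (m + n)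
  m-⊃R-nc  : ∀ {Γ Δ B D n} {d : CProof (B ∷ Γ) (D ∷ Δ)}
             → NonConstr⊃R B Γ D → Measure d n → Measure (⊃R d) (suc n)
  m-⊃R-c   : ∀ {Γ Δ B D n} {d : CProof (B ∷ Γ) (D ∷ Δ)}
             → ¬ NonConstr⊃R B Γ D → Measure d n → Measure (⊃R d) n
  m-∀L     : ∀ {Γ Δ B n t} {d : CProof (inst B t ∷ ∀' B ∷ Γ) Δ} → Measure d n → Measure (∀L t d) n
  m-∃R     : ∀ {Γ Δ B n t} {d : CProof Γ (inst B t ∷ Δ)} → Measure d n → Measure (∃R t d) n
  m-∃L     : ∀ {Γ Δ B n c} {f : FreshIn c (∃' B ∷ Γ) Δ} {d : CProof (inst B (cst c) ∷ Γ) Δ}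
             → Measure d n → Measure (∃L c f d) n
  m-∀R     : ∀ {Γ Δ B n c} {f : FreshIn c Γ (∀' B ∷ Δ)} {d : CProof Γ (inst B (cst c) ∷ Δ)}
             → Measure d n → Measure (∀R c f d) n

_⊆ₘ_ : List Formula → List Formula → Set
Γ ⊆ₘ Γ' = ∃ λ Σ' → (Γ ++ Σ') ↭ Γ'

{-# OPTIONS --safe #-}
module Submission where

-- Append the extra formulas to every sequent of the proof. Eigenvariables of
-- ∃-L / ∀-R that occur in the new formulas are first renamed to fresh
-- constants, so the proof is transformed under a renaming of constants. Such a
-- renaming-weakening also turns I-proofs into I-proofs, hence a constructive
-- occurrence of ∨-L or ⊃-R stays constructive, while a nonconstructive one may
-- become constructive: μ can only drop. Excluded middle is needed only to decide
-- which of the two a weakened nonconstructive occurrence has become.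

open import Defs
open import Data.Nat using (ℕ; _≤_)
open import Data.List using (List)
open import Data.Product using (Σ; _×_)
open import Level using (0ℓ)
open import Axiom.ExcludedMiddle using (ExcludedMiddle)

open import Data.Bool using (true; false)
open import Data.Empty using (⊥-elim)
open import Data.Nat using (suc; _+_; _⊔_; _<ᵇ_; _≡ᵇ_; _≟_; s≤s; z≤n)
open import Data.Nat.Properties
  using (≤-refl; ≤-trans; +-mono-≤; m≤n⇒m≤1+n; 1+n≰n; m≤n⇒m≤n⊔o; m≤n⇒m≤o⊔n)
open import Data.List using ([]; _∷_; _++_; map)
open import Data.List.Properties using (map-++; ++-identityʳ; ++-assoc)
open import Data.List.Relation.Unary.Any using (Any; here; there)
open import Data.List.Membership.Propositional.Properties using (∈-map⁺; ∈-++⁺ˡ)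
open import Data.List.Relation.Binary.Permutation.Propositional
  using (↭-refl; ↭-reflexive; ↭-trans)
open import Data.List.Relation.Binary.Permutation.Propositional.Properties using (map⁺; ++⁺ʳ)
open import Data.Product using (_,_)
open import Data.Sum using (inj₁; inj₂)
open import Function using (id)
open import Relation.Nullary using (¬_; yes; no)
open import Relation.Binary.PropositionalEquality
  using (_≡_; _≢_; refl; sym; cong; cong₂; subst; module ≡-Reasoning)

open ≡-Reasoning

-- Renaming of constants

mutual
  renT : (ℕ → ℕ) → Term → Term
  renT ρ (var i)   = var i
  renT ρ (cst c)   = cst (ρ c)
  renT ρ (fn f ts) = fn f (renTs ρ ts)

  renTs : (ℕ → ℕ) → List Term → List Term
  renTs ρ []       = []
  renTs ρ (t ∷ ts) = renT ρ t ∷ renTs ρ ts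

renF : (ℕ → ℕ) → Formula → Formula
renF ρ (atom p ts) = atom p (renTs ρ ts)
renF ρ ⊤'          = ⊤'
renF ρ ⊥'          = ⊥'
renF ρ (A ∧' B)    = renF ρ A ∧' renF ρ B
renF ρ (A ∨' B)    = renF ρ A ∨' renF ρ B
renF ρ (A ⊃' B)    = renF ρ A ⊃' renF ρ B
renF ρ (∀' A)      = ∀' (renF ρ A)
renF ρ (∃' A)      = ∃' (renF ρ A)

mutual
  renT-shiftT : ∀ ρ k t → renT ρ (shiftT k t) ≡ shiftT k (renT ρ t)
  renT-shiftT ρ k (var i) with i <ᵇ k
  ... | true  = refl
  ... | false = refl
  renT-shiftT ρ k (cst c)   = refl
  renT-shiftT ρ k (fn f ts) = cong (fn f) (renTs-shiftTs ρ k ts)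

  renTs-shiftTs : ∀ ρ k ts → renTs ρ (shiftTs k ts) ≡ shiftTs k (renTs ρ ts)
  renTs-shiftTs ρ k []       = refl
  renTs-shiftTs ρ k (t ∷ ts) = cong₂ _∷_ (renT-shiftT ρ k t) (renTs-shiftTs ρ k ts)

mutual
  renT-substT : ∀ ρ k u t → renT ρ (substT k u t) ≡ substT k (renT ρ u) (renT ρ t)
  renT-substT ρ k u (var i) with i ≡ᵇ k
  ... | true = refl
  ... | false with i <ᵇ k
  ...   | true  = refl
  ...   | false = refl
  renT-substT ρ k u (cst c)   = refl
  renT-substT ρ k u (fn f ts) = cong (fn f) (renTs-substTs ρ k u ts)

  renTs-substTs : ∀ ρ k u ts → renTs ρ (substTs k u ts) ≡ substTs k (renT ρ u) (renTs ρ ts)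
  renTs-substTs ρ k u []       = refl
  renTs-substTs ρ k u (t ∷ ts) = cong₂ _∷_ (renT-substT ρ k u t) (renTs-substTs ρ k u ts)

mutual
  renF-substF : ∀ ρ k u A → renF ρ (substF k u A) ≡ substF k (renT ρ u) (renF ρ A)
  renF-substF ρ k u (atom p ts) = cong (atom p) (renTs-substTs ρ k u ts)
  renF-substF ρ k u ⊤'          = refl
  renF-substF ρ k u ⊥'          = refl
  renF-substF ρ k u (A ∧' B)    = cong₂ _∧'_ (renF-substF ρ k u A) (renF-substF ρ k u B)
  renF-substF ρ k u (A ∨' B)    = cong₂ _∨'_ (renF-substF ρ k u A) (renF-substF ρ k u B)
  renF-substF ρ k u (A ⊃' B)    = cong₂ _⊃'_ (renF-substF ρ k u A) (renF-substF ρ k u B)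
  renF-substF ρ k u (∀' A)      = cong ∀' (renF-substF-binder ρ k u A)
  renF-substF ρ k u (∃' A)      = cong ∃' (renF-substF-binder ρ k u A)

  renF-substF-binder : ∀ ρ k u A →
    renF ρ (substF (suc k) (shiftT 0 u) A) ≡ substF (suc k) (shiftT 0 (renT ρ u)) (renF ρ A)
  renF-substF-binder ρ k u A = begin
    renF ρ (substF (suc k) (shiftT 0 u) A)
      ≡⟨ renF-substF ρ (suc k) (shiftT 0 u) A ⟩
    substF (suc k) (renT ρ (shiftT 0 u)) (renF ρ A)
      ≡⟨ cong (λ v → substF (suc k) v (renF ρ A)) (renT-shiftT ρ 0 u) ⟩
    substF (suc k) (shiftT 0 (renT ρ u)) (renF ρ A) ∎

renF-inst : ∀ ρ B t → renF ρ (inst B t) ≡ inst (renF ρ B) (renT ρ t)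
renF-inst ρ B t = renF-substF ρ 0 t B

renF-AtomOrBot : ∀ ρ {A} → AtomOrBot A → AtomOrBot (renF ρ A)
renF-AtomOrBot ρ (isAtom p ts) = isAtom p (renTs ρ ts)
renF-AtomOrBot ρ isBot         = isBot

mutual
  renT-id : ∀ t → renT id t ≡ t
  renT-id (var i)   = refl
  renT-id (cst c)   = refl
  renT-id (fn f ts) = cong (fn f) (renTs-id ts)

  renTs-id : ∀ ts → renTs id ts ≡ ts
  renTs-id []       = refl
  renTs-id (t ∷ ts) = cong₂ _∷_ (renT-id t) (renTs-id ts)

renF-id : ∀ A → renF id A ≡ A
renF-id (atom p ts) = cong (atom p) (renTs-id ts)
renF-id ⊤'          = refl
renF-id ⊥'          = refl
renF-id (A ∧' B)    = cong₂ _∧'_ (renF-id A) (renF-id B)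
renF-id (A ∨' B)    = cong₂ _∨'_ (renF-id A) (renF-id B)
renF-id (A ⊃' B)    = cong₂ _⊃'_ (renF-id A) (renF-id B)
renF-id (∀' A)      = cong ∀' (renF-id A)
renF-id (∃' A)      = cong ∃' (renF-id A)

map-renF-id : ∀ Γ → map (renF id) Γ ≡ Γ
map-renF-id []      = refl
map-renF-id (A ∷ Γ) = cong₂ _∷_ (renF-id A) (map-renF-id Γ)

AgreeOff : ℕ → (ℕ → ℕ) → (ℕ → ℕ) → Set
AgreeOff c σ τ = ∀ d → c ≢ d → σ d ≡ τ d

mutual
  renT-agree : ∀ {c σ τ} → AgreeOff c σ τ → ∀ t → ¬ OccT c t → renT σ t ≡ renT τ t
  renT-agree ag (var i)   c∉t = refl
  renT-agree ag (cst d)   c∉t = cong cst (ag d c∉t)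
  renT-agree ag (fn f ts) c∉t = cong (fn f) (renTs-agree ag ts c∉t)

  renTs-agree : ∀ {c σ τ} → AgreeOff c σ τ → ∀ ts → ¬ OccTs c ts → renTs σ ts ≡ renTs τ ts
  renTs-agree ag []       c∉ts = refl
  renTs-agree ag (t ∷ ts) c∉ts =
    cong₂ _∷_ (renT-agree ag t (λ o → c∉ts (inj₁ o))) (renTs-agree ag ts (λ o → c∉ts (inj₂ o)))

renF-agree : ∀ {c σ τ} → AgreeOff c σ τ → ∀ A → ¬ OccF c A → renF σ A ≡ renF τ A
renF-agree ag (atom p ts) c∉ = cong (atom p) (renTs-agree ag ts c∉)
renF-agree ag ⊤'          c∉ = refl
renF-agree ag ⊥'          c∉ = refl
renF-agree ag (A ∧' B)    c∉ =
  cong₂ _∧'_ (renF-agree ag A (λ o → c∉ (inj₁ o))) (renF-agree ag B (λ o → c∉ (inj₂ o)))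
renF-agree ag (A ∨' B)    c∉ =
  cong₂ _∨'_ (renF-agree ag A (λ o → c∉ (inj₁ o))) (renF-agree ag B (λ o → c∉ (inj₂ o)))
renF-agree ag (A ⊃' B)    c∉ =
  cong₂ _⊃'_ (renF-agree ag A (λ o → c∉ (inj₁ o))) (renF-agree ag B (λ o → c∉ (inj₂ o)))
renF-agree ag (∀' A)      c∉ = cong ∀' (renF-agree ag A c∉)
renF-agree ag (∃' A)      c∉ = cong ∃' (renF-agree ag A c∉)

map-renF-agree : ∀ {c σ τ} → AgreeOff c σ τ → ∀ Γ → ¬ Any (OccF c) Γ →
                 map (renF σ) Γ ≡ map (renF τ) Γ
map-renF-agree ag []      c∉ = refl
map-renF-agree ag (A ∷ Γ) c∉ =
  cong₂ _∷_ (renF-agree ag A (λ o → c∉ (here o))) (map-renF-agree ag Γ (λ o → c∉ (there o)))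

update : (ℕ → ℕ) → ℕ → ℕ → ℕ → ℕ
update ρ c c' x with x ≟ c
... | yes _ = c'
... | no  _ = ρ x

update-≡ : ∀ ρ c c' → update ρ c c' c ≡ c'
update-≡ ρ c c' with c ≟ c
... | yes _  = refl
... | no c≢c = ⊥-elim (c≢c refl)

update-agreeOff : ∀ ρ c c' → AgreeOff c (update ρ c c') ρ
update-agreeOff ρ c c' d c≢d with d ≟ c
... | yes d≡c = ⊥-elim (c≢d (sym d≡c))
... | no  _   = refl

renF-update-inst : ∀ ρ c c' B → ¬ OccF c B →
                   renF (update ρ c c') (inst B (cst c)) ≡ inst (renF ρ B) (cst c')
renF-update-inst ρ c c' B c∉B = begin
  renF (update ρ c c') (inst B (cst c))
    ≡⟨ renF-inst (update ρ c c') B (cst c) ⟩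
  inst (renF (update ρ c c') B) (cst (update ρ c c' c))
    ≡⟨ cong₂ inst (renF-agree (update-agreeOff ρ c c') B c∉B) (cong cst (update-≡ ρ c c')) ⟩
  inst (renF ρ B) (cst c') ∎

-- Fresh constants

mutual
  maxConstT : Term → ℕ
  maxConstT (var i)   = 0
  maxConstT (cst c)   = c
  maxConstT (fn f ts) = maxConstTs ts

  maxConstTs : List Term → ℕ
  maxConstTs []       = 0
  maxConstTs (t ∷ ts) = maxConstT t ⊔ maxConstTs ts

maxConstF : Formula → ℕ
maxConstF (atom p ts) = maxConstTs ts
maxConstF ⊤'          = 0
maxConstF ⊥'          = 0
maxConstF (A ∧' B)    = maxConstF A ⊔ maxConstF B
maxConstF (A ∨' B)    = maxConstF A ⊔ maxConstF B
maxConstF (A ⊃' B)    = maxConstF A ⊔ maxConstF B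
maxConstF (∀' A)      = maxConstF A
maxConstF (∃' A)      = maxConstF A

maxConstL : List Formula → ℕ
maxConstL []      = 0
maxConstL (A ∷ Γ) = maxConstF A ⊔ maxConstL Γ

mutual
  OccT⇒≤maxConstT : ∀ {c} t → OccT c t → c ≤ maxConstT t
  OccT⇒≤maxConstT (cst d)   refl = ≤-refl
  OccT⇒≤maxConstT (fn f ts) o    = OccTs⇒≤maxConstTs ts o

  OccTs⇒≤maxConstTs : ∀ {c} ts → OccTs c ts → c ≤ maxConstTs ts
  OccTs⇒≤maxConstTs (t ∷ ts) (inj₁ o) = m≤n⇒m≤n⊔o (maxConstTs ts) (OccT⇒≤maxConstT t o)
  OccTs⇒≤maxConstTs (t ∷ ts) (inj₂ o) = m≤n⇒m≤o⊔n (maxConstT t) (OccTs⇒≤maxConstTs ts o)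

OccF⇒≤maxConstF : ∀ {c} A → OccF c A → c ≤ maxConstF A
OccF⇒≤maxConstF (atom p ts) o        = OccTs⇒≤maxConstTs ts o
OccF⇒≤maxConstF (A ∧' B)    (inj₁ o) = m≤n⇒m≤n⊔o (maxConstF B) (OccF⇒≤maxConstF A o)
OccF⇒≤maxConstF (A ∧' B)    (inj₂ o) = m≤n⇒m≤o⊔n (maxConstF A) (OccF⇒≤maxConstF B o)
OccF⇒≤maxConstF (A ∨' B)    (inj₁ o) = m≤n⇒m≤n⊔o (maxConstF B) (OccF⇒≤maxConstF A o)
OccF⇒≤maxConstF (A ∨' B)    (inj₂ o) = m≤n⇒m≤o⊔n (maxConstF A) (OccF⇒≤maxConstF B o)
OccF⇒≤maxConstF (A ⊃' B)    (inj₁ o) = m≤n⇒m≤n⊔o (maxConstF B) (OccF⇒≤maxConstF A o)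
OccF⇒≤maxConstF (A ⊃' B)    (inj₂ o) = m≤n⇒m≤o⊔n (maxConstF A) (OccF⇒≤maxConstF B o)
OccF⇒≤maxConstF (∀' A)      o        = OccF⇒≤maxConstF A o
OccF⇒≤maxConstF (∃' A)      o        = OccF⇒≤maxConstF A o

AnyOccF⇒≤maxConstL : ∀ {c} Γ → Any (OccF c) Γ → c ≤ maxConstL Γ
AnyOccF⇒≤maxConstL (A ∷ Γ) (here o)  = m≤n⇒m≤n⊔o (maxConstL Γ) (OccF⇒≤maxConstF A o)
AnyOccF⇒≤maxConstL (A ∷ Γ) (there o) = m≤n⇒m≤o⊔n (maxConstF A) (AnyOccF⇒≤maxConstL Γ o)

fresh : List Formula → List Formula → ℕ
fresh Γ Δ = suc (maxConstL Γ ⊔ maxConstL Δ)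

fresh-FreshIn : ∀ Γ Δ → FreshIn (fresh Γ Δ) Γ Δ
fresh-FreshIn Γ Δ =
    (λ o → 1+n≰n (≤-trans (AnyOccF⇒≤maxConstL Γ o) (m≤n⇒m≤n⊔o (maxConstL Δ) ≤-refl)))
  , (λ o → 1+n≰n (≤-trans (AnyOccF⇒≤maxConstL Δ o) (m≤n⇒m≤o⊔n (maxConstL Γ) ≤-refl)))

-- Weakening of C-proofs

map-++-regroup : ∀ (f : Formula → Formula) Δ Θ Ψ →
                 (map f Δ ++ []) ++ (map f Θ ++ Ψ) ≡ map f (Δ ++ Θ) ++ Ψ
map-++-regroup f Δ Θ Ψ = begin
  (map f Δ ++ []) ++ (map f Θ ++ Ψ) ≡⟨ cong (_++ (map f Θ ++ Ψ)) (++-identityʳ (map f Δ)) ⟩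
  map f Δ ++ (map f Θ ++ Ψ)         ≡⟨ ++-assoc (map f Δ) (map f Θ) Ψ ⟨
  (map f Δ ++ map f Θ) ++ Ψ         ≡⟨ cong (_++ Ψ) (map-++ f Δ Θ) ⟨
  map f (Δ ++ Θ) ++ Ψ               ∎

rename-weaken : ∀ {Γ Δ} (ρ : ℕ → ℕ) (Φ Ψ : List Formula) → CProof Γ Δ →
                CProof (map (renF ρ) Γ ++ Φ) (map (renF ρ) Δ ++ Ψ)
rename-weaken ρ Φ Ψ (ax⊤ p) = ax⊤ (∈-++⁺ˡ (∈-map⁺ (renF ρ) p))
rename-weaken ρ Φ Ψ (axA a p q) =
  axA (renF-AtomOrBot ρ a) (∈-++⁺ˡ (∈-map⁺ (renF ρ) p)) (∈-++⁺ˡ (∈-map⁺ (renF ρ) q))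
rename-weaken ρ Φ Ψ (perm π σ d) =
  perm (++⁺ʳ Φ (map⁺ (renF ρ) π)) (++⁺ʳ Ψ (map⁺ (renF ρ) σ)) (rename-weaken ρ Φ Ψ d)
rename-weaken ρ Φ Ψ (contrL d)  = contrL (rename-weaken ρ Φ Ψ d)
rename-weaken ρ Φ Ψ (contrR d)  = contrR (rename-weaken ρ Φ Ψ d)
rename-weaken ρ Φ Ψ (⊥R D d)    = ⊥R (renF ρ D) (rename-weaken ρ Φ Ψ d)
rename-weaken ρ Φ Ψ (∧L d)      = ∧L (rename-weaken ρ Φ Ψ d)
rename-weaken ρ Φ Ψ (∧R d e)    = ∧R (rename-weaken ρ Φ Ψ d) (rename-weaken ρ Φ Ψ e)
rename-weaken ρ Φ Ψ (∨L d e)    = ∨L (rename-weaken ρ Φ Ψ d) (rename-weaken ρ Φ Ψ e)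
rename-weaken ρ Φ Ψ (∨R₁ D d)   = ∨R₁ (renF ρ D) (rename-weaken ρ Φ Ψ d)
rename-weaken ρ Φ Ψ (∨R₂ B d)   = ∨R₂ (renF ρ B) (rename-weaken ρ Φ Ψ d)
rename-weaken ρ Φ Ψ (⊃L {Δ = Δ} {Θ = Θ} d e) =
  perm ↭-refl (↭-reflexive (map-++-regroup (renF ρ) Δ Θ Ψ))
       (⊃L (rename-weaken ρ Φ [] d) (rename-weaken ρ Φ Ψ e))
rename-weaken ρ Φ Ψ (⊃R d)      = ⊃R (rename-weaken ρ Φ Ψ d)
rename-weaken ρ Φ Ψ (∀L {B = B} t d) =
  ∀L (renT ρ t) (perm (↭-reflexive (cong (_∷ _) (renF-inst ρ B t))) ↭-refl (rename-weaken ρ Φ Ψ d))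
rename-weaken ρ Φ Ψ (∃R {B = B} t d) =
  ∃R (renT ρ t) (perm ↭-refl (↭-reflexive (cong (_∷ _) (renF-inst ρ B t))) (rename-weaken ρ Φ Ψ d))
rename-weaken ρ Φ Ψ (∃L {Γ = Γ} {Δ = Δ} {B = B} c (c∉∃BΓ , c∉Δ) d) =
  ∃L c' (fresh-FreshIn Γ' Δ')
     (perm (↭-reflexive (cong₂ _∷_ (renF-update-inst ρ c c' B (λ o → c∉∃BΓ (here o)))
                                   (cong (_++ Φ) (map-renF-agree ag Γ (λ o → c∉∃BΓ (there o))))))
           (↭-reflexive (cong (_++ Ψ) (map-renF-agree ag Δ c∉Δ)))
           (rename-weaken (update ρ c c') Φ Ψ d))
  where
  Γ' = map (renF ρ) (∃' B ∷ Γ) ++ Φ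
  Δ' = map (renF ρ) Δ ++ Ψ
  c' = fresh Γ' Δ'
  ag = update-agreeOff ρ c c'
rename-weaken ρ Φ Ψ (∀R {Γ = Γ} {Δ = Δ} {B = B} c (c∉Γ , c∉∀BΔ) d) =
  ∀R c' (fresh-FreshIn Γ' Δ')
     (perm (↭-reflexive (cong (_++ Φ) (map-renF-agree ag Γ c∉Γ)))
           (↭-reflexive (cong₂ _∷_ (renF-update-inst ρ c c' B (λ o → c∉∀BΔ (here o)))
                                   (cong (_++ Ψ) (map-renF-agree ag Δ (λ o → c∉∀BΔ (there o))))))
           (rename-weaken (update ρ c c') Φ Ψ d))
  where
  Γ' = map (renF ρ) Γ ++ Φ
  Δ' = map (renF ρ) (∀' B ∷ Δ) ++ Ψ
  c' = fresh Γ' Δ'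
  ag = update-agreeOff ρ c c'

weaken : ∀ {Γ Δ Γ' Δ'} → Γ ⊆ₘ Γ' → Δ ⊆ₘ Δ' → CProof Γ Δ → CProof Γ' Δ'
weaken {Γ} {Δ} (Φ , Γ++Φ↭Γ') (Ψ , Δ++Ψ↭Δ') d =
  perm (↭-trans (↭-reflexive (cong (_++ Φ) (map-renF-id Γ))) Γ++Φ↭Γ')
       (↭-trans (↭-reflexive (cong (_++ Ψ) (map-renF-id Δ))) Δ++Ψ↭Δ')
       (rename-weaken id Φ Ψ d)

-- I-proofs and the nonconstructiveness measure

One-map-++[] : ∀ (f : Formula → Formula) Δ → One Δ → One (map f Δ ++ [])
One-map-++[] f (A ∷ []) refl = refl

rename-weaken-AllSingle : ∀ {Γ Δ} ρ Φ (d : CProof Γ Δ) → AllSingle d →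
                          AllSingle (rename-weaken ρ Φ [] d)
rename-weaken-AllSingle {Δ = Δ} ρ Φ (ax⊤ p) one = One-map-++[] (renF ρ) Δ one
rename-weaken-AllSingle {Δ = Δ} ρ Φ (axA a p q) one = One-map-++[] (renF ρ) Δ one
rename-weaken-AllSingle {Δ = Δ} ρ Φ (perm π σ d) (one , s) =
  One-map-++[] (renF ρ) Δ one , rename-weaken-AllSingle ρ Φ d s
rename-weaken-AllSingle {Δ = Δ} ρ Φ (contrL d) (one , s) =
  One-map-++[] (renF ρ) Δ one , rename-weaken-AllSingle ρ Φ d s
rename-weaken-AllSingle {Δ = Δ} ρ Φ (contrR d) (one , s) =
  One-map-++[] (renF ρ) Δ one , rename-weaken-AllSingle ρ Φ d s
rename-weaken-AllSingle {Δ = Δ} ρ Φ (⊥R D d) (one , s) =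
  One-map-++[] (renF ρ) Δ one , rename-weaken-AllSingle ρ Φ d s
rename-weaken-AllSingle {Δ = Δ} ρ Φ (∧L d) (one , s) =
  One-map-++[] (renF ρ) Δ one , rename-weaken-AllSingle ρ Φ d s
rename-weaken-AllSingle {Δ = Δ} ρ Φ (∧R d e) (one , s , t) =
  One-map-++[] (renF ρ) Δ one , rename-weaken-AllSingle ρ Φ d s , rename-weaken-AllSingle ρ Φ e t
rename-weaken-AllSingle {Δ = Δ} ρ Φ (∨L d e) (one , s , t) =
  One-map-++[] (renF ρ) Δ one , rename-weaken-AllSingle ρ Φ d s , rename-weaken-AllSingle ρ Φ e t
rename-weaken-AllSingle {Δ = Δ} ρ Φ (∨R₁ D d) (one , s) =
  One-map-++[] (renF ρ) Δ one , rename-weaken-AllSingle ρ Φ d s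
rename-weaken-AllSingle {Δ = Δ} ρ Φ (∨R₂ B d) (one , s) =
  One-map-++[] (renF ρ) Δ one , rename-weaken-AllSingle ρ Φ d s
rename-weaken-AllSingle ρ Φ (⊃L {Δ = Δ} {Θ = Θ} d e) (one , s , t) =
    one'
  , subst One (sym (map-++-regroup (renF ρ) Δ Θ [])) one'
  , rename-weaken-AllSingle ρ Φ d s
  , rename-weaken-AllSingle ρ Φ e t
  where one' = One-map-++[] (renF ρ) (Δ ++ Θ) one
rename-weaken-AllSingle {Δ = Δ} ρ Φ (⊃R d) (one , s) =
  One-map-++[] (renF ρ) Δ one , rename-weaken-AllSingle ρ Φ d s
rename-weaken-AllSingle {Δ = Δ} ρ Φ (∀L t d) (one , s) =
  One-map-++[] (renF ρ) Δ one , One-map-++[] (renF ρ) Δ one , rename-weaken-AllSingle ρ Φ d s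
rename-weaken-AllSingle {Δ = Δ} ρ Φ (∃R t d) (one , s) =
  One-map-++[] (renF ρ) Δ one , One-map-++[] (renF ρ) Δ one , rename-weaken-AllSingle ρ Φ d s
rename-weaken-AllSingle {Δ = Δ} ρ Φ (∃L c f d) (one , s) =
  One-map-++[] (renF ρ) Δ one , One-map-++[] (renF ρ) Δ one , rename-weaken-AllSingle _ Φ d s
rename-weaken-AllSingle {Δ = Δ} ρ Φ (∀R c f d) (one , s) =
  One-map-++[] (renF ρ) Δ one , One-map-++[] (renF ρ) Δ one , rename-weaken-AllSingle _ Φ d s

IProvable-rename-weaken : ∀ {Γ F} ρ Φ → IProvable Γ F → IProvable (map (renF ρ) Γ ++ Φ) (renF ρ F)
IProvable-rename-weaken ρ Φ (d , s) = rename-weaken ρ Φ [] d , rename-weaken-AllSingle ρ Φ d s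

constructive∨L-rename-weaken : ∀ {B D Γ Δ} ρ Φ Ψ → ¬ NonConstr∨L B D Γ Δ →
  ¬ NonConstr∨L (renF ρ B) (renF ρ D) (map (renF ρ) Γ ++ Φ) (map (renF ρ) Δ ++ Ψ)
constructive∨L-rename-weaken ρ Φ Ψ constr nc' = constr λ (F , F∈Δ , iB , iD) →
  nc' ( renF ρ F , ∈-++⁺ˡ (∈-map⁺ (renF ρ) F∈Δ)
      , IProvable-rename-weaken ρ Φ iB , IProvable-rename-weaken ρ Φ iD)

constructive⊃R-rename-weaken : ∀ {B Γ D} ρ Φ → ¬ NonConstr⊃R B Γ D →
  ¬ NonConstr⊃R (renF ρ B) (map (renF ρ) Γ ++ Φ) (renF ρ D)
constructive⊃R-rename-weaken ρ Φ constr nc' = constr λ i → nc' (IProvable-rename-weaken ρ Φ i)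

Measure≤ : ∀ {Γ Δ} → CProof Γ Δ → ℕ → Set
Measure≤ d n = Σ ℕ λ m → Measure d m × m ≤ n

map-Measure≤ : ∀ {Γ Δ Γ' Δ' n} {d : CProof Γ Δ} {d' : CProof Γ' Δ'} →
               (∀ {m} → Measure d m → Measure d' m) → Measure≤ d n → Measure≤ d' n
map-Measure≤ f (m , μ , m≤n) = m , f μ , m≤n

zipWith-Measure≤ : ∀ {Γ₁ Δ₁ Γ₂ Δ₂ Γ Δ n₁ n₂}
                   {d₁ : CProof Γ₁ Δ₁} {d₂ : CProof Γ₂ Δ₂} {d : CProof Γ Δ} →
                   (∀ {m₁ m₂} → Measure d₁ m₁ → Measure d₂ m₂ → Measure d (m₁ + m₂)) →
                   Measure≤ d₁ n₁ → Measure≤ d₂ n₂ → Measure≤ d (n₁ + n₂)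
zipWith-Measure≤ f (m₁ , μ₁ , le₁) (m₂ , μ₂ , le₂) = m₁ + m₂ , f μ₁ μ₂ , +-mono-≤ le₁ le₂

module _ (em : ExcludedMiddle 0ℓ) where

  ∨L-Measure≤ : ∀ {Γ Δ B D n₁ n₂} {d : CProof (B ∷ Γ) Δ} {e : CProof (D ∷ Γ) Δ} →
                Measure≤ d n₁ → Measure≤ e n₂ → Measure≤ (∨L d e) (suc (n₁ + n₂))
  ∨L-Measure≤ {Γ} {Δ} {B} {D} (m₁ , μ₁ , le₁) (m₂ , μ₂ , le₂) with em {NonConstr∨L B D Γ Δ}
  ... | yes nc   = suc (m₁ + m₂) , m-∨L-nc nc μ₁ μ₂ , s≤s (+-mono-≤ le₁ le₂)
  ... | no  ¬nc  = m₁ + m₂ , m-∨L-c ¬nc μ₁ μ₂ , m≤n⇒m≤1+n (+-mono-≤ le₁ le₂)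

  ⊃R-Measure≤ : ∀ {Γ Δ B D n} {d : CProof (B ∷ Γ) (D ∷ Δ)} →
                Measure≤ d n → Measure≤ (⊃R d) (suc n)
  ⊃R-Measure≤ {Γ} {B = B} {D} (m , μ , le) with em {NonConstr⊃R B Γ D}
  ... | yes nc  = suc m , m-⊃R-nc nc μ , s≤s le
  ... | no  ¬nc = m , m-⊃R-c ¬nc μ , m≤n⇒m≤1+n le

  rename-weaken-Measure≤ : ∀ {Γ Δ n} ρ Φ Ψ {d : CProof Γ Δ} →
                           Measure d n → Measure≤ (rename-weaken ρ Φ Ψ d) n
  rename-weaken-Measure≤ ρ Φ Ψ m-ax⊤ = 0 , m-ax⊤ , z≤n
  rename-weaken-Measure≤ ρ Φ Ψ m-axA = 0 , m-axA , z≤n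
  rename-weaken-Measure≤ ρ Φ Ψ (m-perm μ) = map-Measure≤ m-perm (rename-weaken-Measure≤ ρ Φ Ψ μ)
  rename-weaken-Measure≤ ρ Φ Ψ (m-contrL μ) = map-Measure≤ m-contrL (rename-weaken-Measure≤ ρ Φ Ψ μ)
  rename-weaken-Measure≤ ρ Φ Ψ (m-contrR μ) = map-Measure≤ m-contrR (rename-weaken-Measure≤ ρ Φ Ψ μ)
  rename-weaken-Measure≤ ρ Φ Ψ (m-⊥R μ) = map-Measure≤ m-⊥R (rename-weaken-Measure≤ ρ Φ Ψ μ)
  rename-weaken-Measure≤ ρ Φ Ψ (m-∧L μ) = map-Measure≤ m-∧L (rename-weaken-Measure≤ ρ Φ Ψ μ)
  rename-weaken-Measure≤ ρ Φ Ψ (m-∧R μ ν) =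
    zipWith-Measure≤ m-∧R (rename-weaken-Measure≤ ρ Φ Ψ μ) (rename-weaken-Measure≤ ρ Φ Ψ ν)
  rename-weaken-Measure≤ ρ Φ Ψ (m-∨L-nc _ μ ν) =
    ∨L-Measure≤ (rename-weaken-Measure≤ ρ Φ Ψ μ) (rename-weaken-Measure≤ ρ Φ Ψ ν)
  rename-weaken-Measure≤ ρ Φ Ψ (m-∨L-c constr μ ν) =
    zipWith-Measure≤ (m-∨L-c (constructive∨L-rename-weaken ρ Φ Ψ constr))
      (rename-weaken-Measure≤ ρ Φ Ψ μ) (rename-weaken-Measure≤ ρ Φ Ψ ν)
  rename-weaken-Measure≤ ρ Φ Ψ (m-∨R₁ μ) = map-Measure≤ m-∨R₁ (rename-weaken-Measure≤ ρ Φ Ψ μ)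
  rename-weaken-Measure≤ ρ Φ Ψ (m-∨R₂ μ) = map-Measure≤ m-∨R₂ (rename-weaken-Measure≤ ρ Φ Ψ μ)
  rename-weaken-Measure≤ ρ Φ Ψ (m-⊃L μ ν) =
    zipWith-Measure≤ (λ μ' ν' → m-perm (m-⊃L μ' ν'))
      (rename-weaken-Measure≤ ρ Φ [] μ) (rename-weaken-Measure≤ ρ Φ Ψ ν)
  rename-weaken-Measure≤ ρ Φ Ψ (m-⊃R-nc _ μ) = ⊃R-Measure≤ (rename-weaken-Measure≤ ρ Φ Ψ μ)
  rename-weaken-Measure≤ ρ Φ Ψ (m-⊃R-c constr μ) =
    map-Measure≤ (m-⊃R-c (constructive⊃R-rename-weaken ρ Φ constr)) (rename-weaken-Measure≤ ρ Φ Ψ μ)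
  rename-weaken-Measure≤ ρ Φ Ψ (m-∀L μ) =
    map-Measure≤ (λ μ' → m-∀L (m-perm μ')) (rename-weaken-Measure≤ ρ Φ Ψ μ)
  rename-weaken-Measure≤ ρ Φ Ψ (m-∃R μ) =
    map-Measure≤ (λ μ' → m-∃R (m-perm μ')) (rename-weaken-Measure≤ ρ Φ Ψ μ)
  rename-weaken-Measure≤ ρ Φ Ψ (m-∃L μ) =
    map-Measure≤ (λ μ' → m-∃L (m-perm μ')) (rename-weaken-Measure≤ _ Φ Ψ μ)
  rename-weaken-Measure≤ ρ Φ Ψ (m-∀R μ) =
    map-Measure≤ (λ μ' → m-∀R (m-perm μ')) (rename-weaken-Measure≤ _ Φ Ψ μ)

  weaken-Measure≤ : ∀ {Γ Δ Γ' Δ' n} (Γ⊆Γ' : Γ ⊆ₘ Γ') (Δ⊆Δ' : Δ ⊆ₘ Δ') {d : CProof Γ Δ} →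
                    Measure d n → Measure≤ (weaken Γ⊆Γ' Δ⊆Δ' d) n
  weaken-Measure≤ (Φ , _) (Ψ , _) μ = map-Measure≤ m-perm (rename-weaken-Measure≤ id Φ Ψ μ)

lemma3 : ExcludedMiddle 0ℓ →
    (Γ Δ Γ' Δ' : List Formula) → Γ ⊆ₘ Γ' → Δ ⊆ₘ Δ' →
    (n : ℕ) (d : CProof Γ Δ) → Measure d n →
    Σ (CProof Γ' Δ') λ d' → Σ ℕ λ m → Measure d' m × m ≤ n
lemma3 em Γ Δ Γ' Δ' Γ⊆Γ' Δ⊆Δ' n d μ =
  weaken Γ⊆Γ' Δ⊆Δ' d , weaken-Measure≤ em Γ⊆Γ' Δ⊆Δ' μ
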